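{- Let $q=p^m$ with $p$ an odd prime, let $k,f$ be positive integers with $q-1=kf$, and let $g$ be a generator of $\mathbb{F}_q^*$. (i) For all integers $i_1,i_2,i_3$, $$[i_1,i_2,i_3]_k=\alpha+\sum_{v=0}^{k-1}(v-i_3,-i_3)_k\,(i_2-i_1,v-i_1)_k,$$ where $\alpha=f$ if $i_1\equiv i_2+\frac{kf}{2}\pmod k$ and $i_3\equiv 0\pmod k$, and $\alpha=0$ otherwise. (ii) For every integer $i$, $$[i,i,i]_k=\beta+\sum_{v=0}^{k-1}(v,-i)_k\,(0,v)_k,$$ where $\beta=f$ if $i\equiv 0\pmod k$ and $f$ is even, and $\beta=0$ otherwise.
   Context: Notation: $\langle f\rangle=\{0,\dots,f-1\}$. For integers $i,j$, $(i,j)_k$ is the number of $(u_1,u_2)\in\langle f\rangle^2$ with $1+g^{ku_1+i}=g^{ku_2+j}$. For integers $i_1,\dots,i_n$, $[i_1,\dots,i_n]_k$ is the number of $(u_1,\dots,u_n)\in\langle f\rangle^n$ with $g^{ku_1+i_1}+\cdots+g^{ku_n+i_n}=1$. -}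

module Defs where

open import Level using (0ℓ)
open import Data.Nat as ℕ using (ℕ; zero; suc)
open import Data.Integer as ℤ using (ℤ; +_; -[1+_])
open import Data.Fin using (Fin; toℕ)
open import Data.List using (List; map; upTo)
open import Data.Nat.ListAction using (sum)
open import Data.List using () renaming (allFin to finList)
open import Data.Bool using (Bool; if_then_else_)
open import Data.Product using (∃)
open import Relation.Nullary using (¬_; does)
open import Relation.Binary.PropositionalEquality using (_≡_; _≢_)
open import Relation.Binary.Definitions using (DecidableEquality)
open import Algebra.Core using (Op₁; Op₂)
open import Algebra.Structures using (IsCommutativeRing)
open import Function.Bundles using (_↔_)

-- The inverse is a total function whose value at 0 is irrelevant.
record FiniteField : Set₁ where
  infixl 7 _*_
  infixl 6 _+_
  field
    Carrier           : Set
    _+_ _*_           : Op₂ Carrier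
    -_                : Op₁ Carrier
    0# 1#             : Carrier
    _⁻¹               : Op₁ Carrier
    isCommutativeRing : IsCommutativeRing _≡_ _+_ _*_ -_ 0# 1#
    0≢1               : 0# ≢ 1#
    ⁻¹-inverse        : ∀ x → x ≢ 0# → x * (x ⁻¹) ≡ 1#
    _≟_               : DecidableEquality Carrier
    size              : ℕ
    enumeration       : Carrier ↔ Fin size

module _ (F : FiniteField) where
  open FiniteField F

  powℕ : Carrier → ℕ → Carrier
  powℕ x zero    = 1#
  powℕ x (suc n) = x * powℕ x n

  -- integer powers (meaningful for nonzero x): x^(-n) = (x^n)⁻¹
  powℤ : Carrier → ℤ → Carrier
  powℤ x (+ n)     = powℕ x n
  powℤ x -[1+ n ]  = (powℕ x (suc n)) ⁻¹

  IsGenerator : Carrier → Set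
  IsGenerator g = (g ≢ 0#) Data.Product.× (∀ x → x ≢ 0# → ∃ λ n → powℕ g n ≡ x)

  count : (n : ℕ) → (Fin n → Bool) → ℕ
  count n t = sum (map (λ u → if t u then 1 else 0) (finList n))

  count₂ : (n : ℕ) → (Fin n → Fin n → Bool) → ℕ
  count₂ n t = sum (map (λ u₁ → count n (t u₁)) (finList n))

  count₃ : (n : ℕ) → (Fin n → Fin n → Fin n → Bool) → ℕ
  count₃ n t = sum (map (λ u₁ → count₂ n (t u₁)) (finList n))

  gp : Carrier → (k : ℕ) {f : ℕ} → Fin f → ℤ → Carrier
  gp g k u i = powℤ g ((+ k) ℤ.* (+ toℕ u) ℤ.+ i)

  cyc : (g : Carrier) (k f : ℕ) → ℤ → ℤ → ℕ
  cyc g k f i j = count₂ f λ u₁ u₂ → does ((1# + gp g k u₁ i) ≟ gp g k u₂ j)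

  tri : (g : Carrier) (k f : ℕ) → ℤ → ℤ → ℤ → ℕ
  tri g k f i₁ i₂ i₃ = count₃ f λ u₁ u₂ u₃ →
    does ((gp g k u₁ i₁ + gp g k u₂ i₂ + gp g k u₃ i₃) ≟ 1#)

sumBelow : ℕ → (ℕ → ℕ) → ℕ
sumBelow k h = sum (map h (upTo k))

module Submission where

-- Write c(i, y) = g^(k y + i). Since g has order kf (by pigeonhole), every nonzero
-- element is c(i, y) for exactly one i mod k and one y mod f. Group the solutions of
-- c(i₁,u₁) + c(i₂,u₂) + c(i₃,u₃) = 1 by w = 1 - c(i₃,u₃). If w ≠ 0 then w lies in a
-- unique coset v, and dividing by c(i₁,u₁) shows that w is c(i₁,u₁) + c(i₂,u₂) in
-- (i₂ - i₁, v - i₁)_k ways; dividing 1 = c(i₃,u₃) + c(v,a) by c(i₃,u₃) shows that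
-- 1 - c(i₃,u₃) lies in coset v for (v - i₃, -i₃)_k values of u₃. The value w = 0 occurs
-- once if k ∣ i₃ and never otherwise, and since -1 = g^(kf/2) it is c(i₁,u₁) + c(i₂,u₂)
-- in f ways if i₁ + kf/2 ≡ i₂ (mod k) and in none otherwise; this gives α.
-- Part (ii) is the case i₁ = i₂ = i₃, re-indexed using that cyclotomic numbers are
-- k-periodic in both arguments; there k ∣ kf/2 exactly when f is even.

open import Defs
open import Data.Nat as ℕ using (ℕ; suc; NonZero)
open import Relation.Binary.PropositionalEquality using (_≡_)

module Sums where

  open import Data.Nat using (ℕ; zero; suc; _+_; _*_; _∸_; _<_; z≤n; s≤s)
  open import Data.Nat.Properties
  open import Data.Integer as ℤ using (ℤ; +_; -[1+_])
  import Data.Integer.Properties as ℤ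
  open import Data.Integer.Tactic.RingSolver using (solve-∀)
  open import Data.List using (map; applyUpTo; tabulate; allFin)
  open import Data.List.Properties using (map-upTo; map-tabulate)
  open import Data.Nat.ListAction using (sum)
  open import Data.Fin using (toℕ)
  open import Function using (_∘_)
  open import Algebra.Properties.CommutativeSemigroup +-commutativeSemigroup using (interchange)
  open import Relation.Binary.PropositionalEquality

  ∑ : ℕ → (ℕ → ℕ) → ℕ
  ∑ zero    h = 0
  ∑ (suc n) h = h 0 + ∑ n (h ∘ suc)

  sum-applyUpTo : ∀ n (h : ℕ → ℕ) → sum (applyUpTo h n) ≡ ∑ n h
  sum-applyUpTo zero    h = refl
  sum-applyUpTo (suc n) h = cong (_+_ (h 0)) (sum-applyUpTo n (h ∘ suc))

  sumBelow≡∑ : ∀ n (h : ℕ → ℕ) → sumBelow n h ≡ ∑ n h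
  sumBelow≡∑ n h = trans (cong sum (map-upTo h n)) (sum-applyUpTo n h)

  sum-tabulate-toℕ : ∀ n (h : ℕ → ℕ) → sum (tabulate {n = n} (h ∘ toℕ)) ≡ ∑ n h
  sum-tabulate-toℕ zero    h = refl
  sum-tabulate-toℕ (suc n) h = cong (_+_ (h 0)) (sum-tabulate-toℕ n (h ∘ suc))

  sum-map-allFin : ∀ n (h : ℕ → ℕ) → sum (map (h ∘ toℕ) (allFin n)) ≡ ∑ n h
  sum-map-allFin n h = trans (cong sum (map-tabulate {n = n} (λ i → i) (h ∘ toℕ))) (sum-tabulate-toℕ n h)

  ∑-cong : ∀ n {h h′ : ℕ → ℕ} → (∀ u → u < n → h u ≡ h′ u) → ∑ n h ≡ ∑ n h′
  ∑-cong zero    eq = refl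
  ∑-cong (suc n) eq = cong₂ _+_ (eq 0 (s≤s z≤n)) (∑-cong n (λ u u<n → eq (suc u) (s≤s u<n)))

  ∑-cong-≗ : ∀ n {h h′ : ℕ → ℕ} → (∀ u → h u ≡ h′ u) → ∑ n h ≡ ∑ n h′
  ∑-cong-≗ n eq = ∑-cong n (λ u _ → eq u)

  ∑-zero : ∀ n {h : ℕ → ℕ} → (∀ u → u < n → h u ≡ 0) → ∑ n h ≡ 0
  ∑-zero n eq = trans (∑-cong n eq) (∑-const-0 n)
    where
    ∑-const-0 : ∀ n → ∑ n (λ _ → 0) ≡ 0
    ∑-const-0 zero    = refl
    ∑-const-0 (suc n) = ∑-const-0 n

  ∑-const : ∀ n c → ∑ n (λ _ → c) ≡ n * c
  ∑-const zero    c = refl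
  ∑-const (suc n) c = cong (_+_ c) (∑-const n c)

  ∑-single : ∀ n {h : ℕ → ℕ} u₀ → u₀ < n → (∀ u → u < n → u ≢ u₀ → h u ≡ 0) → ∑ n h ≡ h u₀
  ∑-single (suc n) zero     _         eq =
    trans (cong (_+_ _) (∑-zero n (λ u u<n → eq (suc u) (s≤s u<n) (λ ())))) (+-identityʳ _)
  ∑-single (suc n) (suc u₀) (s≤s u₀<n) eq =
    cong₂ _+_ (eq 0 (s≤s z≤n) (λ ())) (∑-single n u₀ u₀<n (λ u u<n u≢u₀ → eq (suc u) (s≤s u<n) (u≢u₀ ∘ suc-injective)))

  ∑-distrib-+ : ∀ n (h h′ : ℕ → ℕ) → ∑ n (λ u → h u + h′ u) ≡ ∑ n h + ∑ n h′
  ∑-distrib-+ zero    h h′ = refl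
  ∑-distrib-+ (suc n) h h′ = trans (cong (_+_ (h 0 + h′ 0)) (∑-distrib-+ n (h ∘ suc) (h′ ∘ suc)))
                                   (interchange (h 0) (h′ 0) _ _)

  ∑-distribʳ-* : ∀ n c (h : ℕ → ℕ) → ∑ n (λ u → h u * c) ≡ ∑ n h * c
  ∑-distribʳ-* zero    c h = refl
  ∑-distribʳ-* (suc n) c h = trans (cong (_+_ (h 0 * c)) (∑-distribʳ-* n c (h ∘ suc))) (sym (*-distribʳ-+ c (h 0) _))

  ∑-comm : ∀ m n (h : ℕ → ℕ → ℕ) → ∑ m (λ a → ∑ n (h a)) ≡ ∑ n (λ b → ∑ m (λ a → h a b))
  ∑-comm zero    n h = sym (∑-zero n (λ _ _ → refl))
  ∑-comm (suc m) n h = trans (cong (_+_ (∑ n (h 0))) (∑-comm m n (h ∘ suc)))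
                             (sym (∑-distrib-+ n (h 0) (λ b → ∑ m (λ a → h (suc a) b))))

  ∑-last : ∀ n (h : ℕ → ℕ) → ∑ (suc n) h ≡ ∑ n h + h n
  ∑-last zero    h = +-comm (h 0) 0
  ∑-last (suc n) h = trans (cong (_+_ (h 0)) (∑-last n (h ∘ suc))) (sym (+-assoc (h 0) _ _))

  ∑-reverse : ∀ n (h : ℕ → ℕ) → ∑ n h ≡ ∑ n (λ u → h (n ∸ suc u))
  ∑-reverse zero    h = refl
  ∑-reverse (suc n) h = trans (∑-last n h) (trans (+-comm (∑ n h) (h n)) (cong (_+_ (h n)) (∑-reverse n h)))

  ∑-rotate : ∀ n (h : ℕ → ℕ) → h n ≡ h 0 → ∑ n (h ∘ suc) ≡ ∑ n h
  ∑-rotate n h hn≡h0 = +-cancelˡ-≡ (h 0) _ _ (trans (∑-last n h) (trans (cong (_+_ (∑ n h)) hn≡h0) (+-comm (∑ n h) (h 0))))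

  suc-invariant⇒constant : (F : ℤ → ℕ) → (∀ t → F (t ℤ.+ + 1) ≡ F t) → ∀ t → F t ≡ F (+ 0)
  suc-invariant⇒constant F inv (+ zero)      = refl
  suc-invariant⇒constant F inv (+ suc s)     = trans (cong (F ∘ +_) (+-comm 1 s)) (trans (inv (+ s)) (suc-invariant⇒constant F inv (+ s)))
  suc-invariant⇒constant F inv -[1+ zero ]   = sym (inv -[1+ zero ])
  suc-invariant⇒constant F inv -[1+ suc s ]  = trans (sym (inv -[1+ suc s ])) (suc-invariant⇒constant F inv -[1+ s ])

  Periodic : ℕ → (ℤ → ℕ) → Set
  Periodic n ψ = ∀ x → ψ (x ℤ.+ + n) ≡ ψ x

  ∑-shift : ∀ n {ψ : ℤ → ℕ} → Periodic n ψ → ∀ t → ∑ n (λ u → ψ (+ u ℤ.+ t)) ≡ ∑ n (ψ ∘ +_)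
  ∑-shift n {ψ} per t = trans (suc-invariant⇒constant shifted step t) (∑-cong-≗ n (λ u → cong ψ (ℤ.+-identityʳ (+ u))))
    where
    shifted : ℤ → ℕ
    shifted t = ∑ n (λ u → ψ (+ u ℤ.+ t))
    step : ∀ t → shifted (t ℤ.+ + 1) ≡ shifted t
    step t = trans (∑-cong-≗ n (λ u → cong ψ (reassoc (+ u) t)))
                   (∑-rotate n (λ u → ψ (+ u ℤ.+ t))
                      (trans (cong ψ (ℤ.+-comm (+ n) t)) (trans (per t) (cong ψ (sym (ℤ.+-identityˡ t))))))
      where
      reassoc : ∀ x t → x ℤ.+ (t ℤ.+ + 1) ≡ (+ 1 ℤ.+ x) ℤ.+ t
      reassoc = solve-∀

  ∑-reflect : ∀ n {ψ : ℤ → ℕ} → Periodic n ψ → ∀ t → ∑ n (λ u → ψ (t ℤ.- + u)) ≡ ∑ n (ψ ∘ +_)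
  ∑-reflect n {ψ} per t = begin
    ∑ n (λ u → ψ (t ℤ.- + u))                          ≡⟨ ∑-reverse n _ ⟩
    ∑ n (λ u → ψ (t ℤ.- + (n ∸ suc u)))                ≡⟨ ∑-cong n (λ u u<n → cong ψ (reflected u u<n)) ⟩
    ∑ n (λ u → ψ (+ u ℤ.+ (t ℤ.+ + 1 ℤ.- + n)))       ≡⟨ ∑-shift n per (t ℤ.+ + 1 ℤ.- + n) ⟩
    ∑ n (ψ ∘ +_)                                       ∎
    where
    open ≡-Reasoning
    reflected : ∀ u → u < n → t ℤ.- + (n ∸ suc u) ≡ + u ℤ.+ (t ℤ.+ + 1 ℤ.- + n)
    reflected u u<n = begin
      t ℤ.- + (n ∸ suc u)                ≡⟨ cong (λ z → t ℤ.- z) (trans (sym (ℤ.⊖-≥ u<n)) (sym (ℤ.m-n≡m⊖n n (suc u)))) ⟩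
      t ℤ.- (+ n ℤ.- (+ 1 ℤ.+ + u))      ≡⟨ identity t (+ n) (+ u) ⟩
      + u ℤ.+ (t ℤ.+ + 1 ℤ.- + n)        ∎
      where
      identity : ∀ t n u → t ℤ.- (n ℤ.- (+ 1 ℤ.+ u)) ≡ u ℤ.+ (t ℤ.+ + 1 ℤ.- n)
      identity = solve-∀

module Congruence where

  open import Data.Nat as ℕ using (ℕ; zero; suc; _≤_; _<_; _∸_; NonZero)
  import Data.Nat.Properties as ℕ
  open import Data.Nat.Divisibility as ℕ using (divides)
  open import Data.Integer using (ℤ; +_; _+_; _-_; -_; _*_)
  open import Data.Integer.Properties using (⊖-≥; m-n≡m⊖n; +-minus-telescope; +-0-abelianGroup; pos-*; *-comm; +-assoc; +-identityʳ)
  import Data.Integer.Divisibility as ℤᵘ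
  open import Data.Integer.DivMod using (_%ℕ_; _/ℕ_; a≡a%ℕn+[a/ℕn]*n)
  open import Data.Integer.Divisibility.Signed as ℤ∣
    using (divides; ∣m∣n⇒∣m+n; ∣m⇒∣-m; ∣⇒∣ᵤ; ∣ᵤ⇒∣) renaming (_∣_ to _∣ₛ_)
  open import Algebra.Properties.AbelianGroup +-0-abelianGroup using (⁻¹-anti-homo‿-)
  open import Data.Integer.Tactic.RingSolver using (solve-∀)
  open import Data.Sum using (inj₁; inj₂)
  open import Function using (_$_; _∘_; _⇔_; mk⇔)
  open import Function.Construct.Composition using (_⇔-∘_)
  open import Relation.Nullary.Decidable using (Dec; map′)
  open import Relation.Binary.PropositionalEquality
  open import Relation.Nullary using (contradiction)

  -- Written a ≡ b [mod n ]: without the space, n] would lex as a single name.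
  infix 4 _≡_[mod_]

  record _≡_[mod_] (a b : ℤ) (n : ℕ) : Set where
    constructor mod
    field
      divides-difference : + n ∣ₛ a - b

  open _≡_[mod_] public

  mod-sym : ∀ {a b n} → a ≡ b [mod n ] → b ≡ a [mod n ]
  mod-sym {a} {b} (mod n∣a-b) = mod $ subst (_ ∣ₛ_) (⁻¹-anti-homo‿- a b) (∣m⇒∣-m n∣a-b)

  mod-trans : ∀ {a b c n} → a ≡ b [mod n ] → b ≡ c [mod n ] → a ≡ c [mod n ]
  mod-trans {a} {b} {c} (mod n∣a-b) (mod n∣b-c) = mod $ subst (_ ∣ₛ_) (+-minus-telescope a b c) (∣m∣n⇒∣m+n n∣a-b n∣b-c)

  mod-residue : ∀ a n .{{_ : NonZero n}} → a ≡ + (a %ℕ n) [mod n ]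
  mod-residue a n = mod $ divides (a /ℕ n) (trans (cong (_- + (a %ℕ n)) (a≡a%ℕn+[a/ℕn]*n a n)) (cancel (+ (a %ℕ n)) _))
    where
    cancel : ∀ r m → r + m - r ≡ m
    cancel = solve-∀

  mod⇒∣∸ : ∀ {x y n} → + x ≡ + y [mod n ] → y ≤ x → n ℕ.∣ x ∸ y
  mod⇒∣∸ {x} {y} (mod n∣x-y) y≤x = subst (_ ℕ.∣_) (cong ∣_∣ (trans (m-n≡m⊖n x y) (⊖-≥ y≤x))) (∣⇒∣ᵤ n∣x-y)
    where open Data.Integer using (∣_∣)

  ∣∧<⇒≡0 : ∀ {n d} → n ℕ.∣ d → d < n → d ≡ 0
  ∣∧<⇒≡0 {d = zero}  _   _   = refl
  ∣∧<⇒≡0 {d = suc _} n∣d d<n = contradiction n∣d (ℕ.>⇒∤ d<n)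

  mod-injective-< : ∀ {x y n} → + x ≡ + y [mod n ] → x < n → y < n → x ≡ y
  mod-injective-< {x} {y} x≡y x<n y<n with ℕ.≤-total y x
  ... | inj₁ y≤x =
    ℕ.≤-antisym (ℕ.m∸n≡0⇒m≤n (∣∧<⇒≡0 (mod⇒∣∸ x≡y y≤x) (ℕ.≤-<-trans (ℕ.m∸n≤m x y) x<n))) y≤x
  ... | inj₂ x≤y =
    ℕ.≤-antisym x≤y (ℕ.m∸n≡0⇒m≤n (∣∧<⇒≡0 (mod⇒∣∸ (mod-sym x≡y) x≤y) (ℕ.≤-<-trans (ℕ.m∸n≤m y x) y<n)))

  mod-+ : ∀ {a b c d n} → a ≡ b [mod n ] → c ≡ d [mod n ] → a + c ≡ b + d [mod n ]
  mod-+ {a} {b} {c} {d} (mod n∣a-b) (mod n∣c-d) = mod $ subst (_ ∣ₛ_) (interchange a b c d) (∣m∣n⇒∣m+n n∣a-b n∣c-d)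
    where
    interchange : ∀ a b c d → (a - b) + (c - d) ≡ (a + c) - (b + d)
    interchange = solve-∀

  mod-reflexive : ∀ {a b n} → a ≡ b → a ≡ b [mod n ]
  mod-reflexive {a} {n = n} refl = mod (divides (+ 0) (a-a≡0*n a (+ n)))
    where
    a-a≡0*n : ∀ a n → a - a ≡ + 0 * n
    a-a≡0*n = solve-∀

  mod-scale : ∀ m {a b n} → a ≡ b [mod n ] → + m * a ≡ + m * b [mod m ℕ.* n ]
  mod-scale m {a} {b} {n} (mod (divides q a-b≡qn)) = mod (divides q (begin
    + m * a - + m * b    ≡⟨ *-distribˡ-minus (+ m) a b ⟩
    + m * (a - b)        ≡⟨ cong (+ m *_) a-b≡qn ⟩
    + m * (q * + n)      ≡⟨ swap (+ m) q (+ n) ⟩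
    q * (+ m * + n)      ≡⟨ cong (q *_) (pos-* m n) ⟨
    q * + (m ℕ.* n)      ∎))
    where
    open ≡-Reasoning
    *-distribˡ-minus : ∀ m a b → m * a - m * b ≡ m * (a - b)
    *-distribˡ-minus = solve-∀
    swap : ∀ m q n → m * (q * n) ≡ q * (m * n)
    swap = solve-∀

  mod-unscale : ∀ m .{{_ : NonZero m}} {a b n} → + m * a ≡ + m * b [mod m ℕ.* n ] → a ≡ b [mod n ]
  mod-unscale m {a} {b} {n} (mod mn∣ma-mb) =
    mod (∣ᵤ⇒∣ (ℤᵘ.*-cancelˡ-∣ (+ m) (subst₂ ℤᵘ._∣_ (pos-* m n) (factor (+ m) a b) (∣⇒∣ᵤ mn∣ma-mb))))
    where
    factor : ∀ m a b → m * a - m * b ≡ m * (a - b)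
    factor = solve-∀

  mod-weaken : ∀ m {a b n} → a ≡ b [mod m ℕ.* n ] → a ≡ b [mod m ]
  mod-weaken m {n = n} (mod mn∣a-b) = mod (ℤ∣.∣-trans (divides (+ n) (trans (pos-* m n) (*-comm (+ m) (+ n)))) mn∣a-b)

  mod-multiple : ∀ m a c → + m * a + c ≡ c [mod m ]
  mod-multiple m a c = mod (divides a (cancel (+ m) a c))
    where
    cancel : ∀ m a c → m * a + c - c ≡ a * m
    cancel = solve-∀

  mod-cancel-+ʳ : ∀ {a b c n} → a + c ≡ b + c [mod n ] → a ≡ b [mod n ]
  mod-cancel-+ʳ {a} {b} {c} (mod n∣a+c-b-c) = mod (subst (_ ∣ₛ_) (cancel a b c) n∣a+c-b-c)
    where
    cancel : ∀ a b c → (a + c) - (b + c) ≡ a - b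
    cancel = solve-∀

  mod-+n : ∀ a n → a + + n ≡ a [mod n ]
  mod-+n a n = mod (divides (+ 1) (cancel a (+ n)))
    where
    cancel : ∀ a n → a + n - a ≡ + 1 * n
    cancel = solve-∀

  _≡?_[mod_] : ∀ a b n → Dec (a ≡ b [mod n ])
  a ≡? b [mod n ] = map′ mod divides-difference (+ n ℤ∣.∣? a - b)

  ∣ᵤ⇔mod : ∀ {a b n} → (+ n ℤᵘ.∣ a - b) ⇔ (a ≡ b [mod n ])
  ∣ᵤ⇔mod = mk⇔ (mod ∘ ∣ᵤ⇒∣) (∣⇒∣ᵤ ∘ divides-difference)

  module _ {k f h : ℕ} (h+h≡kf : h ℕ.+ h ≡ k ℕ.* f) where

    mod-+double-half : ∀ a → a + + (h ℕ.+ h) ≡ a [mod k ]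
    mod-+double-half a = mod (divides (+ f) (begin
      a + + (h ℕ.+ h) - a    ≡⟨ cong (λ z → a + + z - a) h+h≡kf ⟩
      a + + (k ℕ.* f) - a    ≡⟨ cong (λ z → a + z - a) (pos-* k f) ⟩
      a + + k * + f - a      ≡⟨ cancel a (+ k) (+ f) ⟩
      + f * + k              ∎))
      where
      open ≡-Reasoning
      cancel : ∀ a k f → a + k * f - a ≡ f * k
      cancel = solve-∀

    mod-half-shift : ∀ {a b} → (a ≡ b + + h [mod k ]) ⇔ (a + + h ≡ b [mod k ])
    mod-half-shift {a} {b} = mk⇔
      (λ a≡b+h → mod-trans (mod-+ a≡b+h (mod-reflexive refl)) (mod-trans (mod-reflexive (+-assoc b (+ h) (+ h))) (mod-+double-half b)))
      (λ a+h≡b → mod-trans (mod-trans (mod-sym (mod-+double-half a)) (mod-reflexive (sym (+-assoc a (+ h) (+ h))))) (mod-+ a+h≡b (mod-reflexive refl)))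

    ∣ᵤ⇔mod-half-shift : ∀ {a b} → (+ k ℤᵘ.∣ a - (b + + h)) ⇔ (a + + h ≡ b [mod k ])
    ∣ᵤ⇔mod-half-shift {a} {b} = mod-half-shift {a} {b} ⇔-∘ ∣ᵤ⇔mod

  ∣ᵤ⇔mod-0 : ∀ {i n} → (+ n ℤᵘ.∣ i) ⇔ (i ≡ + 0 [mod n ])
  ∣ᵤ⇔mod-0 {i} {n} = subst (λ j → (+ n ℤᵘ.∣ j) ⇔ (i ≡ + 0 [mod n ])) (+-identityʳ i) ∣ᵤ⇔mod

module FieldProperties (F : FiniteField) where

  open import Level using (0ℓ)
  open import Algebra.Bundles using (CommutativeRing)
  open import Data.Sum using (_⊎_; inj₁; inj₂)
  open import Relation.Binary.PropositionalEquality
  open import Relation.Nullary using (yes; no)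
  open import Function using (_⇔_; mk⇔)

  open FiniteField F

  commutativeRing : CommutativeRing 0ℓ 0ℓ
  commutativeRing = record { isCommutativeRing = isCommutativeRing }

  open CommutativeRing commutativeRing public
    using (+-comm; -‿inverseʳ; *-assoc; *-comm; *-identityˡ; *-identityʳ; distribˡ; zeroˡ; zeroʳ; ring)
  open import Algebra.Properties.Ring ring public
    using (-1*x≈-x; +-inverseʳ-unique; x≈z//y; //-rightDividesˡ; x∙y⁻¹≈ε⇒x≈y; x≈y⇒x∙y⁻¹≈ε)

  ⁻¹-inverseˡ : ∀ x → x ≢ 0# → x ⁻¹ * x ≡ 1#
  ⁻¹-inverseˡ x x≢0 = trans (*-comm (x ⁻¹) x) (⁻¹-inverse x x≢0)

  *-cancelˡ : ∀ {x} → x ≢ 0# → ∀ y z → x * y ≡ x * z → y ≡ z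
  *-cancelˡ {x} x≢0 y z xy≡xz = begin
    y                ≡⟨ cancel y ⟨
    x ⁻¹ * (x * y)   ≡⟨ cong (x ⁻¹ *_) xy≡xz ⟩
    x ⁻¹ * (x * z)   ≡⟨ cancel z ⟩
    z                ∎
    where
    open ≡-Reasoning
    cancel : ∀ y → x ⁻¹ * (x * y) ≡ y
    cancel y = trans (sym (*-assoc _ x y)) (trans (cong (_* y) (⁻¹-inverseˡ x x≢0)) (*-identityˡ y))

  *-cancelʳ : ∀ {x} → x ≢ 0# → ∀ y z → y * x ≡ z * x → y ≡ z
  *-cancelʳ {x} x≢0 y z yx≡zx = *-cancelˡ x≢0 y z (trans (*-comm x y) (trans yx≡zx (*-comm z x)))

  x*y≢0 : ∀ {x y} → x ≢ 0# → y ≢ 0# → x * y ≢ 0#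
  x*y≢0 {x} {y} x≢0 y≢0 xy≡0 = y≢0 (*-cancelˡ x≢0 y 0# (trans xy≡0 (sym (zeroʳ x))))

  ⁻¹-unique : ∀ x y → x * y ≡ 1# → x ⁻¹ ≡ y
  ⁻¹-unique x y xy≡1 = *-cancelˡ x≢0 (x ⁻¹) y (trans (⁻¹-inverse x x≢0) (sym xy≡1))
    where
    x≢0 : x ≢ 0#
    x≢0 x≡0 = 0≢1 (trans (sym (zeroˡ y)) (trans (cong (_* y) (sym x≡0)) xy≡1))

  x*x≡1⇒x≡±1 : ∀ x → x * x ≡ 1# → x ≡ 1# ⊎ x ≡ - 1#
  x*x≡1⇒x≡±1 x x²≡1 with (1# + x) ≟ 0#
  ... | yes 1+x≡0 = inj₂ (+-inverseʳ-unique 1# x 1+x≡0)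
  ... | no  1+x≢0 = inj₁ (*-cancelʳ 1+x≢0 x 1# (begin
    x * (1# + x)      ≡⟨ distribˡ x 1# x ⟩
    x * 1# + x * x    ≡⟨ cong₂ _+_ (*-identityʳ x) x²≡1 ⟩
    x + 1#            ≡⟨ +-comm x 1# ⟩
    1# + x            ≡⟨ *-identityˡ (1# + x) ⟨
    1# * (1# + x)     ∎))
    where open ≡-Reasoning

  +-move-⇔ : ∀ x y z → (x + y ≡ z) ⇔ (x ≡ z + - y)
  +-move-⇔ x y z = mk⇔ (x≈z//y x y z) (λ x≡z-y → trans (cong (_+ y) x≡z-y) (//-rightDividesˡ y z))

  +≡0-⇔ : ∀ x y → (x + y ≡ 0#) ⇔ (y ≡ - x)
  +≡0-⇔ x y = mk⇔ (+-inverseʳ-unique x y) (λ y≡-x → trans (cong (x +_) y≡-x) (-‿inverseʳ x))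

  x*-1≡-x : ∀ x → x * - 1# ≡ - x
  x*-1≡-x x = trans (*-comm x (- 1#)) (-1*x≈-x x)

module Powers (F : FiniteField) {g : FiniteField.Carrier F} (gen : IsGenerator F g)
              {N : ℕ} .{{_ : NonZero N}} (size≡1+N : FiniteField.size F ≡ suc N) where

  open import Data.Nat as ℕ using (ℕ; zero; suc; _≤_; _<_; _∸_; NonZero; _%_; z≤n)
  import Data.Nat.Properties as ℕ
  open import Data.Nat.DivMod using (m≡m%n+[m/n]*n; m%n<n)
  open import Data.Nat.Divisibility using (divides)
  open import Data.Integer as ℤ using (ℤ; +_; -[1+_])
  open import Data.Integer.DivMod using (_%ℕ_; n%ℕd<d)
  open import Data.Integer.Divisibility.Signed using (∣m⇒∣-m) renaming (_∣_ to _∣ₛ_)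
  open import Data.Integer.Tactic.RingSolver using (solve-∀)
  open import Data.Fin as Fin using (Fin; toℕ; fromℕ; fromℕ<; punchOut; cast)
  import Data.Fin.Properties as Fin
  open import Data.Product using (∃; _×_; _,_; proj₁; proj₂)
  open import Data.Sum using (inj₁; inj₂)
  open import Function using (_∘_; Inverse; _⇔_; mk⇔)
  open import Relation.Binary.PropositionalEquality
  open import Relation.Nullary using (Dec; yes; no; contradiction)
  open FieldProperties F
  open Congruence

  open FiniteField F

  pow : ℕ → Carrier
  pow = powℕ F g

  pow-+ : ∀ m n → pow (m ℕ.+ n) ≡ pow m * pow n
  pow-+ zero    n = sym (*-identityˡ _)
  pow-+ (suc m) n = trans (cong (g *_) (pow-+ m n)) (sym (*-assoc g (pow m) (pow n)))

  pow≢0 : ∀ n → pow n ≢ 0#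
  pow≢0 zero    = 0≢1 ∘ sym
  pow≢0 (suc n) = x*y≢0 (proj₁ gen) (pow≢0 n)

  pow-multiple : ∀ {d} → pow d ≡ 1# → ∀ s → pow (s ℕ.* d) ≡ 1#
  pow-multiple     gᵈ≡1 zero    = refl
  pow-multiple {d} gᵈ≡1 (suc s) = trans (pow-+ d (s ℕ.* d)) (trans (cong₂ _*_ gᵈ≡1 (pow-multiple gᵈ≡1 s)) (*-identityˡ 1#))

  pow-∸ : ∀ {a b} → a ≤ b → pow a ≡ pow b → pow (b ∸ a) ≡ 1#
  pow-∸ {a} {b} a≤b gᵃ≡gᵇ = sym (*-cancelˡ (pow≢0 a) 1# (pow (b ∸ a)) (begin
    pow a * 1#            ≡⟨ *-identityʳ _ ⟩
    pow a                 ≡⟨ gᵃ≡gᵇ ⟩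
    pow b                 ≡⟨ cong pow (ℕ.m+[n∸m]≡n a≤b) ⟨
    pow (a ℕ.+ (b ∸ a))   ≡⟨ pow-+ a (b ∸ a) ⟩
    pow a * pow (b ∸ a)   ∎))
    where open ≡-Reasoning

  open Inverse enumeration using (to; from; strictlyInverseˡ; strictlyInverseʳ)

  -- Sending 0 to d and gⁿ to n mod d is injective once gᵈ = 1.
  size≤1+period : ∀ d .{{_ : NonZero d}} → pow d ≡ 1# → size ≤ suc d
  size≤1+period d gᵈ≡1 = Fin.injective⇒≤ {f = code ∘ from} (λ {i} {j} eq → from-injective (code-injective _ _ eq))
    where
    from-injective : ∀ {i j} → from i ≡ from j → i ≡ j
    from-injective {i} {j} eq = trans (sym (strictlyInverseˡ i)) (trans (cong to eq) (strictlyInverseˡ j))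

    log : ∀ {x} → x ≢ 0# → ℕ
    log x≢0 = proj₁ (proj₂ gen _ x≢0)

    pow-log : ∀ {x} (x≢0 : x ≢ 0#) → pow (log x≢0) ≡ x
    pow-log x≢0 = proj₂ (proj₂ gen _ x≢0)

    pow-% : ∀ n → pow (n % d) ≡ pow n
    pow-% n = sym (begin
      pow n                                  ≡⟨ cong pow (m≡m%n+[m/n]*n n d) ⟩
      pow (n % d ℕ.+ n ℕ./ d ℕ.* d)          ≡⟨ pow-+ (n % d) _ ⟩
      pow (n % d) * pow (n ℕ./ d ℕ.* d)      ≡⟨ cong (pow (n % d) *_) (pow-multiple gᵈ≡1 (n ℕ./ d)) ⟩
      pow (n % d) * 1#                       ≡⟨ *-identityʳ _ ⟩
      pow (n % d)                            ∎)
      where open ≡-Reasoning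

    code′ : ∀ x → Dec (x ≡ 0#) → Fin (suc d)
    code′ x (yes _)   = fromℕ d
    code′ x (no x≢0) = fromℕ< (ℕ.m<n⇒m<1+n (m%n<n (log x≢0) d))

    code : Carrier → Fin (suc d)
    code x = code′ x (x ≟ 0#)

    residue≡d : ∀ {x} (x≢0 : x ≢ 0#) → code′ x (no x≢0) ≡ fromℕ d → log x≢0 % d ≡ d
    residue≡d x≢0 eq = trans (sym (Fin.toℕ-fromℕ< _)) (trans (cong toℕ eq) (Fin.toℕ-fromℕ d))

    code-injective : ∀ x y → code x ≡ code y → x ≡ y
    code-injective x y eq with x ≟ 0# | y ≟ 0#
    ... | yes x≡0 | yes y≡0 = trans x≡0 (sym y≡0)
    ... | yes _   | no y≢0  = contradiction (residue≡d y≢0 (sym eq)) (ℕ.<⇒≢ (m%n<n (log y≢0) d))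
    ... | no x≢0  | yes _   = contradiction (residue≡d x≢0 eq) (ℕ.<⇒≢ (m%n<n (log x≢0) d))
    ... | no x≢0  | no y≢0  = begin
      x                   ≡⟨ pow-log x≢0 ⟨
      pow (log x≢0)       ≡⟨ pow-% _ ⟨
      pow (log x≢0 % d)   ≡⟨ cong pow (trans (sym (Fin.toℕ-fromℕ< _)) (trans (cong toℕ eq) (Fin.toℕ-fromℕ< _))) ⟩
      pow (log y≢0 % d)   ≡⟨ pow-% _ ⟩
      pow (log y≢0)       ≡⟨ pow-log y≢0 ⟩
      y                   ∎
      where open ≡-Reasoning

  period-bound : ∀ {d} → 1 ≤ d → pow d ≡ 1# → N ≤ d
  period-bound {suc d} _ gᵈ≡1 = ℕ.≤-pred (subst (_≤ suc (suc d)) size≡1+N (size≤1+period (suc d) gᵈ≡1))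

  index : Carrier → Fin (suc N)
  index x = cast size≡1+N (to x)

  index-injective : ∀ {x y} → index x ≡ index y → x ≡ y
  index-injective {x} {y} eq = trans (sym (strictlyInverseʳ x)) (trans (cong from to-x≡to-y) (strictlyInverseʳ y))
    where
    to-x≡to-y : to x ≡ to y
    to-x≡to-y = Fin.toℕ-injective (trans (sym (Fin.toℕ-cast _ (to x))) (trans (cong toℕ eq) (Fin.toℕ-cast _ (to y))))

  index0≢index-pow : ∀ n → index 0# ≢ index (pow n)
  index0≢index-pow n eq = pow≢0 n (sym (index-injective eq))

  -- Pigeonhole: the N + 1 powers g⁰, …, gᴺ take at most N (nonzero) values.
  period≤N : ∃ λ d → 1 ≤ d × d ≤ N × pow d ≡ 1#
  period≤N with Fin.pigeonhole (ℕ.n<1+n N) (λ i → punchOut (index0≢index-pow (toℕ i)))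
  ... | i , j , i<j , eq =
    toℕ j ∸ toℕ i , ℕ.m<n⇒0<n∸m i<j , ℕ.≤-trans (ℕ.m∸n≤m (toℕ j) (toℕ i)) (ℕ.≤-pred (Fin.toℕ<n j)) ,
    pow-∸ (ℕ.<⇒≤ i<j) (index-injective (Fin.punchOut-injective (index0≢index-pow (toℕ i)) (index0≢index-pow (toℕ j)) eq))

  pow-N : pow N ≡ 1#
  pow-N with period≤N
  ... | d , 1≤d , d≤N , gᵈ≡1 = subst (λ n → pow n ≡ 1#) (ℕ.≤-antisym d≤N (period-bound 1≤d gᵈ≡1)) gᵈ≡1

  pow-injective-≤ : ∀ {a b} → a ≤ b → b < N → pow a ≡ pow b → a ≡ b
  pow-injective-≤ {a} {b} a≤b b<N gᵃ≡gᵇ with ℕ.m≤n⇒m<n∨m≡n a≤b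
  ... | inj₂ a≡b = a≡b
  ... | inj₁ a<b = contradiction (period-bound (ℕ.m<n⇒0<n∸m a<b) (pow-∸ a≤b gᵃ≡gᵇ))
                                 (ℕ.<⇒≱ (ℕ.≤-<-trans (ℕ.m∸n≤m b a) b<N))

  pow-injective : ∀ {a b} → a < N → b < N → pow a ≡ pow b → a ≡ b
  pow-injective {a} {b} a<N b<N gᵃ≡gᵇ with ℕ.≤-total a b
  ... | inj₁ a≤b = pow-injective-≤ a≤b b<N gᵃ≡gᵇ
  ... | inj₂ b≤a = sym (pow-injective-≤ b≤a a<N (sym gᵃ≡gᵇ))

  pow-mod-≥ : ∀ {x y} → + x ≡ + y [mod N ] → y ≤ x → pow x ≡ pow y
  pow-mod-≥ {x} {y} x≡y y≤x with mod⇒∣∸ x≡y y≤x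
  ... | divides s x∸y≡s*N = begin
    pow x                    ≡⟨ cong pow (ℕ.m+[n∸m]≡n y≤x) ⟨
    pow (y ℕ.+ (x ∸ y))      ≡⟨ pow-+ y (x ∸ y) ⟩
    pow y * pow (x ∸ y)      ≡⟨ cong (λ n → pow y * pow n) x∸y≡s*N ⟩
    pow y * pow (s ℕ.* N)    ≡⟨ cong (pow y *_) (pow-multiple pow-N s) ⟩
    pow y * 1#               ≡⟨ *-identityʳ (pow y) ⟩
    pow y                    ∎
    where open ≡-Reasoning

  pow-mod : ∀ {x y} → + x ≡ + y [mod N ] → pow x ≡ pow y
  pow-mod {x} {y} x≡y with ℕ.≤-total y x
  ... | inj₁ y≤x = pow-mod-≥ x≡y y≤x
  ... | inj₂ x≤y = sym (pow-mod-≥ (mod-sym x≡y) x≤y)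

  g^_ : ℤ → Carrier
  g^_ = powℤ F g

  g^-residue : ∀ a → g^ a ≡ pow (a %ℕ N)
  g^-residue (+ n)    = pow-mod (mod-residue (+ n) N)
  g^-residue -[1+ n ] = ⁻¹-unique (pow (suc n)) _ (trans (sym (pow-+ (suc n) r)) (pow-mod 1+n+r≡0))
    where
    r : ℕ
    r = -[1+ n ] %ℕ N
    negate : ∀ s r → ℤ.- ((ℤ.- s) ℤ.- r) ≡ s ℤ.+ r ℤ.- + 0
    negate = solve-∀
    1+n+r≡0 : + (suc n ℕ.+ r) ≡ + 0 [mod N ]
    1+n+r≡0 = mod (subst (_ ∣ₛ_) (negate (+ suc n) (+ r)) (∣m⇒∣-m (divides-difference (mod-residue -[1+ n ] N))))

  g^-mod : ∀ {a b} → a ≡ b [mod N ] → g^ a ≡ g^ b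
  g^-mod {a} {b} a≡b = begin
    g^ a               ≡⟨ g^-residue a ⟩
    pow (a %ℕ N)       ≡⟨ pow-mod (mod-trans (mod-sym (mod-residue a N)) (mod-trans a≡b (mod-residue b N))) ⟩
    pow (b %ℕ N)       ≡⟨ g^-residue b ⟨
    g^ b               ∎
    where open ≡-Reasoning

  g^-+ : ∀ a b → g^ (a ℤ.+ b) ≡ g^ a * g^ b
  g^-+ a b = begin
    g^ (a ℤ.+ b)                      ≡⟨ g^-mod (mod-+ (mod-residue a N) (mod-residue b N)) ⟩
    pow (a %ℕ N ℕ.+ b %ℕ N)           ≡⟨ pow-+ (a %ℕ N) (b %ℕ N) ⟩
    pow (a %ℕ N) * pow (b %ℕ N)       ≡⟨ cong₂ _*_ (g^-residue a) (g^-residue b) ⟨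
    g^ a * g^ b                       ∎
    where open ≡-Reasoning

  g^-injective-mod : ∀ {a b} → g^ a ≡ g^ b → a ≡ b [mod N ]
  g^-injective-mod {a} {b} gᵃ≡gᵇ =
    mod-trans (mod-residue a N) (subst (λ r → + r ≡ b [mod N ]) (sym residues≡) (mod-sym (mod-residue b N)))
    where
    residues≡ : a %ℕ N ≡ b %ℕ N
    residues≡ = pow-injective (n%ℕd<d a N) (n%ℕd<d b N) (trans (sym (g^-residue a)) (trans gᵃ≡gᵇ (g^-residue b)))

  g^≢0 : ∀ a → g^ a ≢ 0#
  g^≢0 a gᵃ≡0 = pow≢0 (a %ℕ N) (trans (sym (g^-residue a)) gᵃ≡0)

  g^-half : ∀ {h} → h ℕ.+ h ≡ N → g^ (+ h) ≡ - 1#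
  g^-half {h} h+h≡N with x*x≡1⇒x≡±1 (pow h) (trans (sym (pow-+ h h)) (trans (cong pow h+h≡N) pow-N))
  ... | inj₂ gʰ≡-1 = gʰ≡-1
  ... | inj₁ gʰ≡1  = contradiction (pow-injective h<N (ℕ.≤-<-trans z≤n h<N) gʰ≡1) h≢0
    where
    h≢0 : h ≢ 0
    h≢0 refl = ℕ.≢-nonZero⁻¹ N (sym h+h≡N)
    h<N : h < N
    h<N = subst (h <_) h+h≡N (ℕ.m<m+n h (ℕ.n≢0⇒n>0 h≢0))

  g^-split : ∀ a b → g^ b ≡ g^ a * g^ (b ℤ.- a)
  g^-split a b = trans (cong g^_ (b≡a+[b-a] a b)) (g^-+ a (b ℤ.- a))
    where
    b≡a+[b-a] : ∀ a b → b ≡ a ℤ.+ (b ℤ.- a)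
    b≡a+[b-a] = solve-∀

  g^+g^≡g^⇔ : ∀ a b c → (g^ a + g^ b ≡ g^ c) ⇔ (1# + g^ (b ℤ.- a) ≡ g^ (c ℤ.- a))
  g^+g^≡g^⇔ a b c = mk⇔
    (λ eq → *-cancelˡ (g^≢0 a) _ _ (trans (sym factored) (trans eq (g^-split a c))))
    (λ eq → trans factored (trans (cong (g^ a *_) eq) (sym (g^-split a c))))
    where
    factored : g^ a + g^ b ≡ g^ a * (1# + g^ (b ℤ.- a))
    factored = trans (cong₂ _+_ (sym (*-identityʳ (g^ a))) (g^-split a b)) (sym (distribˡ (g^ a) 1# _))

module Cyclotomy (F : FiniteField) {g : FiniteField.Carrier F} (gen : IsGenerator F g)
                 (k f : ℕ) .{{_ : NonZero k}} .{{_ : NonZero f}}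
                 (size≡1+kf : FiniteField.size F ≡ suc (k ℕ.* f)) where

  open import Data.Nat as ℕ using (ℕ; suc; _<_; NonZero)
  import Data.Nat.Properties as ℕ
  open import Data.Nat.DivMod using (m≡m%n+[m/n]*n; m%n<n)
  open import Data.Integer as ℤ using (ℤ; +_)
  import Data.Integer.Properties as ℤ
  open import Data.Integer.Tactic.RingSolver using (solve-∀)
  open import Data.Integer.DivMod using (n%ℕd<d)
  open import Data.Integer.Divisibility.Signed using (divides)
  open import Data.Bool using (if_then_else_)
  open import Data.List using () renaming (allFin to finList)
  import Data.List.Properties as List
  open import Data.Nat.ListAction using (sum)
  open import Data.Product using (_×_; _,_; proj₂)
  open import Function using (_∘_; _⇔_; mk⇔; Equivalence)
  open import Relation.Binary.PropositionalEquality
  open import Relation.Nullary using (¬_; does; yes; no)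
  open import Relation.Nullary.Decidable using (dec-true; dec-false; does-⇔)
  open Sums
  open Congruence

  open FiniteField F
  open FieldProperties F
  open Powers F gen {{ℕ.m*n≢0 k f}} size≡1+kf

  -- The summand of Defs' count, so that cyc and tri unfold to sums of δ.
  δ : Carrier → Carrier → ℕ
  δ x y = if does (x ≟ y) then 1 else 0

  δ-≡ : ∀ {x y} → x ≡ y → δ x y ≡ 1
  δ-≡ {x} {y} x≡y rewrite dec-true (x ≟ y) x≡y = refl

  δ-≢ : ∀ {x y} → x ≢ y → δ x y ≡ 0
  δ-≢ {x} {y} x≢y rewrite dec-false (x ≟ y) x≢y = refl

  δ-⇔ : ∀ {x y x′ y′} → (x ≡ y ⇔ x′ ≡ y′) → δ x y ≡ δ x′ y′
  δ-⇔ {x} {y} {x′} {y′} iff = cong (λ b → if b then 1 else 0) (does-⇔ iff (x ≟ y) (x′ ≟ y′))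

  -- coset c (+ u) is Defs' gp g k u c; the index ranges over ℤ so that sums can be shifted.
  coset : ℤ → ℤ → Carrier
  coset c y = g^ (+ k ℤ.* y ℤ.+ c)

  cyclotomic : ℤ → ℤ → ℕ
  cyclotomic i j = ∑ f λ u₁ → ∑ f λ u₂ → δ (1# + coset i (+ u₁)) (coset j (+ u₂))

  cyc≡cyclotomic : ∀ i j → cyc F g k f i j ≡ cyclotomic i j
  cyc≡cyclotomic i j = trans (cong sum (List.map-cong (λ u₁ → sum-map-allFin f _) (finList f))) (sum-map-allFin f _)

  tri≡∑ : ∀ i₁ i₂ i₃ → tri F g k f i₁ i₂ i₃ ≡
          ∑ f λ u₁ → ∑ f λ u₂ → ∑ f λ u₃ → δ (coset i₁ (+ u₁) + coset i₂ (+ u₂) + coset i₃ (+ u₃)) 1#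
  tri≡∑ i₁ i₂ i₃ = trans (cong sum (List.map-cong (λ u₁ →
                     trans (cong sum (List.map-cong (λ u₂ → sum-map-allFin f _) (finList f))) (sum-map-allFin f _)) (finList f)))
                   (sum-map-allFin f _)

  coset-mod : ∀ c {y y′} → y ≡ y′ [mod f ] → coset c y ≡ coset c y′
  coset-mod c {y} {y′} y≡y′ = g^-mod {+ k ℤ.* y ℤ.+ c} {+ k ℤ.* y′ ℤ.+ c} (mod-+ (mod-scale k y≡y′) (mod-reflexive refl))

  coset-periodic : ∀ c y → coset c (y ℤ.+ + f) ≡ coset c y
  coset-periodic c y = coset-mod c (mod-+n y f)

  coset-residue : ∀ c s → coset c (+ (s ℤ.%ℕ f)) ≡ coset c s
  coset-residue c s = coset-mod c (mod-sym (mod-residue s f))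

  coset-injective : ∀ {c u s} → u < f → coset c (+ u) ≡ coset c s → u ≡ s ℤ.%ℕ f
  coset-injective {c} {u} {s} u<f eq = mod-injective-< u≡s%f u<f (n%ℕd<d s f)
    where
    u≡s%f : + u ≡ + (s ℤ.%ℕ f) [mod f ]
    u≡s%f = mod-trans (mod-unscale k (mod-cancel-+ʳ (g^-injective-mod eq))) (mod-residue s f)

  ∑δ-coset : ∀ {c d} → c ≡ d [mod k ] → ∑ f (λ u → δ (coset c (+ u)) (g^ d)) ≡ 1
  ∑δ-coset {c} {d} (mod (divides t c-d≡tk)) = trans (∑-single f (s ℤ.%ℕ f) (n%ℕd<d s f) missed) (δ-≡ hit)
    where
    s : ℤ
    s = ℤ.- t
    d≡coset : g^ d ≡ coset c s
    d≡coset = cong g^_ (trans (double-negation c d) (trans (cong (ℤ._-_ c) c-d≡tk) (rearrange c t (+ k))))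
      where
      double-negation : ∀ c d → d ≡ c ℤ.- (c ℤ.- d)
      double-negation = solve-∀
      rearrange : ∀ c t k → c ℤ.- t ℤ.* k ≡ k ℤ.* ℤ.- t ℤ.+ c
      rearrange = solve-∀
    hit : coset c (+ (s ℤ.%ℕ f)) ≡ g^ d
    hit = trans (coset-residue c s) (sym d≡coset)
    missed : ∀ u → u < f → u ≢ s ℤ.%ℕ f → δ (coset c (+ u)) (g^ d) ≡ 0
    missed u u<f u≢u₀ = δ-≢ (λ eq → u≢u₀ (coset-injective u<f (trans eq d≡coset)))

  ∑δ-coset-≢ : ∀ {c d} → ¬ (c ≡ d [mod k ]) → ∑ f (λ u → δ (coset c (+ u)) (g^ d)) ≡ 0
  ∑δ-coset-≢ {c} {d} c≢d = ∑-zero f λ u _ → δ-≢ λ eq →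
    c≢d (mod-trans (mod-sym (mod-multiple k (+ u) c)) (mod-weaken k (g^-injective-mod eq)))

  ∑-coset-shift : ∀ (φ : Carrier → ℕ) c t → ∑ f (λ u → φ (coset c (+ u ℤ.+ t))) ≡ ∑ f (λ u → φ (coset c (+ u)))
  ∑-coset-shift φ c = ∑-shift f (λ y → cong φ (coset-periodic c y))

  ∑-coset-reflect : ∀ (φ : Carrier → ℕ) c t → ∑ f (λ u → φ (coset c (t ℤ.- + u))) ≡ ∑ f (λ u → φ (coset c (+ u)))
  ∑-coset-reflect φ c = ∑-reflect f (λ y → cong φ (coset-periodic c y))

  coset+coset≡coset⇔ : ∀ α β γ u w c →
    (coset α u + coset β w ≡ coset γ c) ⇔ (1# + coset (β ℤ.- α) (w ℤ.- u) ≡ coset (γ ℤ.- α) (c ℤ.- u))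
  coset+coset≡coset⇔ α β γ u w c =
    subst₂ (λ x y → (coset α u + coset β w ≡ coset γ c) ⇔ (1# + g^ x ≡ g^ y))
           (quotient (+ k) u w α β) (quotient (+ k) u c α γ)
           (g^+g^≡g^⇔ (+ k ℤ.* u ℤ.+ α) (+ k ℤ.* w ℤ.+ β) (+ k ℤ.* c ℤ.+ γ))
    where
    quotient : ∀ k u w α β → (k ℤ.* w ℤ.+ β) ℤ.- (k ℤ.* u ℤ.+ α) ≡ k ℤ.* (w ℤ.- u) ℤ.+ (β ℤ.- α)
    quotient = solve-∀

  -- Dividing by the first summand and re-indexing the two sums.
  ∑∑δ-homogeneous : ∀ α β γ c →
    ∑ f (λ u → ∑ f (λ w → δ (coset α (+ u) + coset β (+ w)) (coset γ c))) ≡ cyclotomic (β ℤ.- α) (γ ℤ.- α)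
  ∑∑δ-homogeneous α β γ c = begin
    ∑ f (λ u → ∑ f (λ w → δ (coset α (+ u) + coset β (+ w)) (coset γ c)))
      ≡⟨ ∑-cong-≗ f (λ u → ∑-cong-≗ f (λ w → δ-⇔ (coset+coset≡coset⇔ α β γ (+ u) (+ w) c))) ⟩
    ∑ f (λ u → ∑ f (λ w → δ (1# + coset B (+ w ℤ.- + u)) (coset C (c ℤ.- + u))))
      ≡⟨ ∑-cong-≗ f (λ u → ∑-coset-shift (λ x → δ (1# + x) (coset C (c ℤ.- + u))) B (ℤ.- + u)) ⟩
    ∑ f (λ u → ∑ f (λ w → δ (1# + coset B (+ w)) (coset C (c ℤ.- + u))))
      ≡⟨ ∑-coset-reflect (λ y → ∑ f (λ w → δ (1# + coset B (+ w)) y)) C c ⟩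
    ∑ f (λ u → ∑ f (λ w → δ (1# + coset B (+ w)) (coset C (+ u))))
      ≡⟨ ∑-comm f f _ ⟩
    cyclotomic B C
      ∎
    where
    open ≡-Reasoning
    B C : ℤ
    B = β ℤ.- α
    C = γ ℤ.- α

  ∑-coset-+k : ∀ (φ : Carrier → ℕ) c → ∑ f (λ u → φ (coset (c ℤ.+ + k) (+ u))) ≡ ∑ f (λ u → φ (coset c (+ u)))
  ∑-coset-+k φ c = trans (∑-cong-≗ f (λ u → cong (φ ∘ g^_) (next (+ k) (+ u) c))) (∑-coset-shift φ c (+ 1))
    where
    next : ∀ k y c → k ℤ.* y ℤ.+ (c ℤ.+ k) ≡ k ℤ.* (y ℤ.+ + 1) ℤ.+ c
    next = solve-∀

  cyclotomic-periodicˡ : ∀ j → Periodic k (λ i → cyclotomic i j)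
  cyclotomic-periodicˡ j = ∑-coset-+k (λ x → ∑ f (λ u₂ → δ (1# + x) (coset j (+ u₂))))

  cyclotomic-periodicʳ : ∀ i → Periodic k (cyclotomic i)
  cyclotomic-periodicʳ i j = ∑-cong-≗ f (λ u₁ → ∑-coset-+k (δ (1# + coset i (+ u₁))) j)

  multiplicity : ℕ → Carrier → ℕ
  multiplicity v w = ∑ f λ a → δ (coset (+ v) (+ a)) w

  g^-as-coset : ∀ n → g^ (+ n) ≡ coset (+ (n ℕ.% k)) (+ (n ℕ./ k))
  g^-as-coset n = cong g^_ (begin
    + n                                          ≡⟨ cong +_ (m≡m%n+[m/n]*n n k) ⟩
    + (n ℕ.% k) ℤ.+ + (n ℕ./ k ℕ.* k)            ≡⟨ cong (ℤ._+_ (+ (n ℕ.% k))) (ℤ.pos-* (n ℕ./ k) k) ⟩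
    + (n ℕ.% k) ℤ.+ + (n ℕ./ k) ℤ.* + k          ≡⟨ rearrange (+ (n ℕ.% k)) (+ (n ℕ./ k)) (+ k) ⟩
    + k ℤ.* + (n ℕ./ k) ℤ.+ + (n ℕ.% k)          ∎)
    where
    open ≡-Reasoning
    rearrange : ∀ r q k → r ℤ.+ q ℤ.* k ≡ k ℤ.* q ℤ.+ r
    rearrange = solve-∀

  ∑-multiplicity-g^ : ∀ (M : ℕ → ℕ) n → ∑ k (λ v → multiplicity v (g^ (+ n)) ℕ.* M v) ≡ M (n ℕ.% k)
  ∑-multiplicity-g^ M n = trans (∑-single k (n ℕ.% k) (m%n<n n k) missed)
                                (trans (cong (ℕ._* M (n ℕ.% k)) (∑δ-coset (mod-sym (mod-residue (+ n) k)))) (ℕ.*-identityˡ _))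
    where
    missed : ∀ v → v < k → v ≢ n ℕ.% k → multiplicity v (g^ (+ n)) ℕ.* M v ≡ 0
    missed v v<k v≢n%k = cong (ℕ._* M v) (∑δ-coset-≢ λ v≡n →
      v≢n%k (mod-injective-< (mod-trans v≡n (mod-residue (+ n) k)) v<k (m%n<n n k)))

  ∑-multiplicity-0 : ∀ (M : ℕ → ℕ) → ∑ k (λ v → multiplicity v 0# ℕ.* M v) ≡ 0
  ∑-multiplicity-0 M = ∑-zero k λ v _ → cong (ℕ._* M v) (∑-zero f λ a _ → δ-≢ (g^≢0 (+ k ℤ.* + a ℤ.+ + v)))

  coset-+half : ∀ {h} → h ℕ.+ h ≡ k ℕ.* f → ∀ c y → coset (c ℤ.+ + h) y ≡ - coset c y
  coset-+half {h} h+h≡kf c y = begin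
    g^ (+ k ℤ.* y ℤ.+ (c ℤ.+ + h))      ≡⟨ cong g^_ (ℤ.+-assoc (+ k ℤ.* y) c (+ h)) ⟨
    g^ (+ k ℤ.* y ℤ.+ c ℤ.+ + h)        ≡⟨ g^-+ (+ k ℤ.* y ℤ.+ c) (+ h) ⟩
    coset c y * g^ (+ h)                ≡⟨ cong (coset c y *_) (g^-half {h} h+h≡kf) ⟩
    coset c y * - 1#                    ≡⟨ x*-1≡-x (coset c y) ⟩
    - coset c y                         ∎
    where open ≡-Reasoning

  δ-complement : ∀ x → δ (1# + - x) 0# ≡ δ x 1#
  δ-complement x = δ-⇔ (mk⇔ (λ 1-x≡0 → sym (x∙y⁻¹≈ε⇒x≈y 1# x 1-x≡0)) (λ x≡1 → x≈y⇒x∙y⁻¹≈ε (sym x≡1)))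

  ∑-multiplicity-complement : ∀ c v → ∑ f (λ u → multiplicity v (1# + - coset c (+ u))) ≡ cyclotomic (+ v ℤ.- c) (ℤ.- c)
  ∑-multiplicity-complement c v = begin
    ∑ f (λ u → ∑ f (λ a → δ (coset (+ v) (+ a)) (1# + - coset c (+ u))))
      ≡⟨ ∑-cong-≗ f (λ u → ∑-cong-≗ f (λ a → δ-⇔ (complement (coset (+ v) (+ a)) (coset c (+ u))))) ⟩
    ∑ f (λ u → ∑ f (λ a → δ (coset c (+ u) + coset (+ v) (+ a)) (coset (+ 0) (+ 0))))
      ≡⟨ ∑∑δ-homogeneous c (+ v) (+ 0) (+ 0) ⟩
    cyclotomic (+ v ℤ.- c) (+ 0 ℤ.- c)
      ≡⟨ cong (cyclotomic (+ v ℤ.- c)) (ℤ.+-identityˡ (ℤ.- c)) ⟩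
    cyclotomic (+ v ℤ.- c) (ℤ.- c)
      ∎
    where
    open ≡-Reasoning
    coset00≡1 : coset (+ 0) (+ 0) ≡ 1#
    coset00≡1 = cong g^_ (trans (ℤ.+-identityʳ (+ k ℤ.* + 0)) (ℤ.*-zeroʳ (+ k)))
    complement : ∀ x y → (x ≡ 1# + - y) ⇔ (y + x ≡ coset (+ 0) (+ 0))
    complement x y = mk⇔
      (λ x≡1-y → trans (+-comm y x) (trans (Equivalence.from (+-move-⇔ x y 1#) x≡1-y) (sym coset00≡1)))
      (λ y+x≡1 → Equivalence.to (+-move-⇔ x y 1#) (trans (+-comm x y) (trans y+x≡1 coset00≡1)))

  module PairCount (i₁ i₂ : ℤ) where

    pairCount : Carrier → ℕ
    pairCount w = ∑ f λ u₁ → ∑ f λ u₂ → δ (coset i₁ (+ u₁) + coset i₂ (+ u₂)) w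

    pairCyclotomic : ℕ → ℕ
    pairCyclotomic v = cyclotomic (i₂ ℤ.- i₁) (+ v ℤ.- i₁)

    pairCount-g^ : ∀ n → pairCount (g^ (+ n)) ≡ pairCyclotomic (n ℕ.% k)
    pairCount-g^ n = trans (cong pairCount (g^-as-coset n)) (∑∑δ-homogeneous i₁ i₂ (+ (n ℕ.% k)) (+ (n ℕ./ k)))

    -- A nonzero w lies in exactly one coset, which determines pairCount w.
    pairCount-split : ∀ w → pairCount w ≡ δ w 0# ℕ.* pairCount 0# ℕ.+ ∑ k (λ v → multiplicity v w ℕ.* pairCyclotomic v)
    pairCount-split w with w ≟ 0#
    ... | yes refl = sym (trans (cong₂ ℕ._+_ (ℕ.*-identityˡ (pairCount 0#)) (∑-multiplicity-0 pairCyclotomic)) (ℕ.+-identityʳ _))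
    ... | no w≢0 with proj₂ gen w w≢0
    ...   | n , refl = trans (pairCount-g^ n) (sym (∑-multiplicity-g^ pairCyclotomic n))

    convolution : ℤ → ℕ
    convolution i₃ = ∑ k (λ v → cyclotomic (+ v ℤ.- i₃) (ℤ.- i₃) ℕ.* pairCyclotomic v)

    tri≡∑pairCount : ∀ i₃ → tri F g k f i₁ i₂ i₃ ≡ ∑ f (λ u₃ → pairCount (1# + - coset i₃ (+ u₃)))
    tri≡∑pairCount i₃ = begin
      tri F g k f i₁ i₂ i₃
        ≡⟨ tri≡∑ i₁ i₂ i₃ ⟩
      ∑ f (λ u₁ → ∑ f (λ u₂ → ∑ f (λ u₃ → δ (c₁ u₁ + c₂ u₂ + c₃ u₃) 1#)))
        ≡⟨ ∑-cong-≗ f (λ u₁ → ∑-comm f f _) ⟩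
      ∑ f (λ u₁ → ∑ f (λ u₃ → ∑ f (λ u₂ → δ (c₁ u₁ + c₂ u₂ + c₃ u₃) 1#)))
        ≡⟨ ∑-comm f f _ ⟩
      ∑ f (λ u₃ → ∑ f (λ u₁ → ∑ f (λ u₂ → δ (c₁ u₁ + c₂ u₂ + c₃ u₃) 1#)))
        ≡⟨ ∑-cong-≗ f (λ u₃ → ∑-cong-≗ f (λ u₁ → ∑-cong-≗ f (λ u₂ → δ-⇔ (+-move-⇔ _ (c₃ u₃) 1#)))) ⟩
      ∑ f (λ u₃ → pairCount (1# + - c₃ u₃))
        ∎
      where
      open ≡-Reasoning
      c₁ c₂ c₃ : ℕ → Carrier
      c₁ u = coset i₁ (+ u)
      c₂ u = coset i₂ (+ u)
      c₃ u = coset i₃ (+ u)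

    tri-decomposition : ∀ i₃ → tri F g k f i₁ i₂ i₃ ≡ ∑ f (λ u → δ (coset i₃ (+ u)) 1#) ℕ.* pairCount 0# ℕ.+ convolution i₃
    tri-decomposition i₃ = begin
      tri F g k f i₁ i₂ i₃
        ≡⟨ tri≡∑pairCount i₃ ⟩
      ∑ f (λ u → pairCount (1# + - c₃ u))
        ≡⟨ ∑-cong-≗ f (λ u → pairCount-split (1# + - c₃ u)) ⟩
      ∑ f (λ u → δ (1# + - c₃ u) 0# ℕ.* pairCount 0# ℕ.+ ∑ k (λ v → multiplicity v (1# + - c₃ u) ℕ.* pairCyclotomic v))
        ≡⟨ ∑-distrib-+ f _ _ ⟩
      ∑ f (λ u → δ (1# + - c₃ u) 0# ℕ.* pairCount 0#) ℕ.+ ∑ f (λ u → ∑ k (λ v → multiplicity v (1# + - c₃ u) ℕ.* pairCyclotomic v))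
        ≡⟨ cong₂ ℕ._+_ (∑-distribʳ-* f (pairCount 0#) _) (∑-comm f k _) ⟩
      ∑ f (λ u → δ (1# + - c₃ u) 0#) ℕ.* pairCount 0# ℕ.+ ∑ k (λ v → ∑ f (λ u → multiplicity v (1# + - c₃ u) ℕ.* pairCyclotomic v))
        ≡⟨ cong₂ ℕ._+_ (cong (ℕ._* pairCount 0#) (∑-cong-≗ f (δ-complement ∘ c₃)))
                       (∑-cong-≗ k (λ v → trans (∑-distribʳ-* f (pairCyclotomic v) _)
                                                (cong (ℕ._* pairCyclotomic v) (∑-multiplicity-complement i₃ v)))) ⟩
      ∑ f (λ u → δ (c₃ u) 1#) ℕ.* pairCount 0# ℕ.+ ∑ k (λ v → cyclotomic (+ v ℤ.- i₃) (ℤ.- i₃) ℕ.* pairCyclotomic v)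
        ∎
      where
      open ≡-Reasoning
      c₃ : ℕ → Carrier
      c₃ u = coset i₃ (+ u)

    module _ {h : ℕ} (h+h≡kf : h ℕ.+ h ≡ k ℕ.* f) where

      pairCount-0≡∑ : pairCount 0# ≡ ∑ f (λ u₁ → ∑ f (λ u₂ → δ (coset i₂ (+ u₂)) (g^ (+ k ℤ.* + u₁ ℤ.+ (i₁ ℤ.+ + h)))))
      pairCount-0≡∑ = ∑-cong-≗ f λ u₁ → ∑-cong-≗ f λ u₂ →
        δ-⇔ (opposite (coset i₁ (+ u₁)) (coset i₂ (+ u₂)) (coset-+half h+h≡kf i₁ (+ u₁)))
        where
        opposite : ∀ x y {z} → z ≡ - x → (x + y ≡ 0#) ⇔ (y ≡ z)
        opposite x y refl = +≡0-⇔ x y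

      pairCount-0-≡ : i₁ ℤ.+ + h ≡ i₂ [mod k ] → pairCount 0# ≡ f
      pairCount-0-≡ i₁+h≡i₂ =
        trans pairCount-0≡∑ (trans (∑-cong-≗ f λ u₁ → ∑δ-coset (i₂≡ u₁)) (trans (∑-const f 1) (ℕ.*-identityʳ f)))
        where
        i₂≡ : ∀ u₁ → i₂ ≡ + k ℤ.* + u₁ ℤ.+ (i₁ ℤ.+ + h) [mod k ]
        i₂≡ u₁ = mod-trans (mod-sym i₁+h≡i₂) (mod-sym (mod-multiple k (+ u₁) (i₁ ℤ.+ + h)))

      pairCount-0-≢ : ¬ (i₁ ℤ.+ + h ≡ i₂ [mod k ]) → pairCount 0# ≡ 0
      pairCount-0-≢ i₁+h≢i₂ = trans pairCount-0≡∑ (∑-zero f λ u₁ _ → ∑δ-coset-≢ λ i₂≡ →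
        i₁+h≢i₂ (mod-sym (mod-trans i₂≡ (mod-multiple k (+ u₁) (i₁ ℤ.+ + h)))))

      tri-formula-≡ : ∀ i₃ → i₁ ℤ.+ + h ≡ i₂ [mod k ] → i₃ ≡ + 0 [mod k ] → tri F g k f i₁ i₂ i₃ ≡ f ℕ.+ convolution i₃
      tri-formula-≡ i₃ i₁+h≡i₂ i₃≡0 = trans (tri-decomposition i₃)
        (cong (ℕ._+ convolution i₃) (trans (cong₂ ℕ._*_ (∑δ-coset i₃≡0) (pairCount-0-≡ i₁+h≡i₂)) (ℕ.*-identityˡ f)))

      tri-formula-≢ : ∀ i₃ → ¬ (i₁ ℤ.+ + h ≡ i₂ [mod k ] × i₃ ≡ + 0 [mod k ]) → tri F g k f i₁ i₂ i₃ ≡ convolution i₃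
      tri-formula-≢ i₃ ¬both = trans (tri-decomposition i₃) (cong (ℕ._+ convolution i₃) product≡0)
        where
        A₀ : ℕ
        A₀ = ∑ f (λ u → δ (coset i₃ (+ u)) 1#)
        product≡0 : A₀ ℕ.* pairCount 0# ≡ 0
        product≡0 with i₃ ≡? + 0 [mod k ]
        ... | no  i₃≢0 = cong (ℕ._* pairCount 0#) (∑δ-coset-≢ i₃≢0)
        ... | yes i₃≡0 = trans (cong (ℕ._*_ A₀) (pairCount-0-≢ λ i₁+h≡i₂ → ¬both (i₁+h≡i₂ , i₃≡0))) (ℕ.*-zeroʳ A₀)

  convolution-diagonal : ∀ i → PairCount.convolution i i i ≡ ∑ k (λ v → cyclotomic (+ v) (ℤ.- i) ℕ.* cyclotomic (+ 0) (+ v))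
  convolution-diagonal i = begin
    ∑ k (λ v → cyclotomic (+ v ℤ.- i) (ℤ.- i) ℕ.* cyclotomic (i ℤ.- i) (+ v ℤ.- i))
      ≡⟨ ∑-cong-≗ k (λ v → cong (λ z → cyclotomic (+ v ℤ.- i) (ℤ.- i) ℕ.* cyclotomic z (+ v ℤ.- i)) (ℤ.+-inverseʳ i)) ⟩
    ∑ k (λ v → ω (+ v ℤ.- i))
      ≡⟨ ∑-shift k ω-periodic (ℤ.- i) ⟩
    ∑ k (λ v → ω (+ v))
      ∎
    where
    open ≡-Reasoning
    ω : ℤ → ℕ
    ω x = cyclotomic x (ℤ.- i) ℕ.* cyclotomic (+ 0) x
    ω-periodic : Periodic k ω
    ω-periodic x = cong₂ ℕ._*_ (cyclotomic-periodicˡ (ℤ.- i) x) (cyclotomic-periodicʳ (+ 0) x)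

  sumBelow-cyc≡∑ : ∀ (a b c d : ℕ → ℤ) →
    sumBelow k (λ v → cyc F g k f (a v) (b v) ℕ.* cyc F g k f (c v) (d v)) ≡ ∑ k (λ v → cyclotomic (a v) (b v) ℕ.* cyclotomic (c v) (d v))
  sumBelow-cyc≡∑ a b c d = trans (sumBelow≡∑ k _)
    (∑-cong-≗ k (λ v → cong₂ ℕ._*_ (cyc≡cyclotomic (a v) (b v)) (cyc≡cyclotomic (c v) (d v))))

  convolution≡sumBelow : ∀ i₁ i₂ i₃ →
    PairCount.convolution i₁ i₂ i₃ ≡ sumBelow k (λ v → cyc F g k f (+ v ℤ.- i₃) (ℤ.- i₃) ℕ.* cyc F g k f (i₂ ℤ.- i₁) (+ v ℤ.- i₁))
  convolution≡sumBelow i₁ i₂ i₃ =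
    sym (sumBelow-cyc≡∑ (λ v → + v ℤ.- i₃) (λ _ → ℤ.- i₃) (λ _ → i₂ ℤ.- i₁) (λ v → + v ℤ.- i₁))

  sumBelow-diagonal : ∀ i →
    sumBelow k (λ v → cyc F g k f (+ v ℤ.- i) (ℤ.- i) ℕ.* cyc F g k f (i ℤ.- i) (+ v ℤ.- i)) ≡
    sumBelow k (λ v → cyc F g k f (+ v) (ℤ.- i) ℕ.* cyc F g k f (+ 0) (+ v))
  sumBelow-diagonal i = trans (sym (convolution≡sumBelow i i i))
    (trans (convolution-diagonal i) (sym (sumBelow-cyc≡∑ (λ v → + v) (λ _ → ℤ.- i) (λ _ → + 0) (λ v → + v))))

open import Data.Nat using (_^_; _∸_; _*_; _+_; _/_; _≤_; zero; s≤s; _%_)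
open import Data.Nat.Primality using (Prime)
open import Data.Integer using (ℤ; +_; -_)
open import Data.Integer.Divisibility using () renaming (_∣_ to _∣ℤ_)
open import Data.Nat.Divisibility using (_∣_)
open import Data.Product using (_×_)
open import Relation.Nullary using (¬_)
import Data.Nat.Properties as ℕ
open import Data.Nat.DivMod using (m≡m%n+[m/n]*n; m%n<n; m/n*n≡m)
open import Data.Nat.Divisibility using (divides; _∣0; ∣1⇒≡1; m%n≡0⇒n∣m; *-monoʳ-∣; *-cancelˡ-∣)
open import Data.Nat.Primality using (euclidsLemma; prime[2])
import Data.Integer as ℤ
import Data.Integer.Properties as ℤ
open import Data.Integer.Tactic.RingSolver using (solve-∀)
open import Data.Product using (_,_; proj₁; proj₂)
open import Data.Sum using ([_,_]′)
open import Function using (_⇔_; mk⇔; Equivalence)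
open Equivalence using (to; from)
open import Relation.Binary.PropositionalEquality using (refl; sym; trans; cong; subst; subst₂)
open import Relation.Nullary using (contradiction)

open Congruence

odd-^ : ∀ {p} m → ¬ 2 ∣ p → ¬ 2 ∣ p ^ m
odd-^     zero    _   2∣1     = contradiction (∣1⇒≡1 2∣1) λ ()
odd-^ {p} (suc m) 2∤p 2∣pᵐ⁺¹ = [ 2∤p , odd-^ m 2∤p ]′ (euclidsLemma p (p ^ m) prime[2] 2∣pᵐ⁺¹)

odd⇒2∣pred : ∀ n → ¬ 2 ∣ n → 2 ∣ n ∸ 1
odd⇒2∣pred n 2∤n with n % 2 | m%n<n n 2 | m≡m%n+[m/n]*n n 2 | m%n≡0⇒n∣m n 2
... | zero        | _             | _        | 2∣n = contradiction (2∣n refl) 2∤n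
... | suc zero    | _             | n≡1+q*2  | _   = divides (n / 2) (cong (_∸ 1) n≡1+q*2)
... | suc (suc _) | s≤s (s≤s ()) | _        | _

odd⇒suc-even : ∀ {q n} → ¬ 2 ∣ q → q ∸ 1 ≡ n → q ≡ suc n × 2 ∣ n
odd⇒suc-even {q} 2∤q refl = sym (ℕ.m+[n∸m]≡n {1} 1≤q) , odd⇒2∣pred q 2∤q
  where
  1≤q : 1 ≤ q
  1≤q = ℕ.n≢0⇒n>0 λ q≡0 → 2∤q (subst (2 ∣_) (sym q≡0) (2 ∣0))

half+half : ∀ {n} → 2 ∣ n → n / 2 + n / 2 ≡ n
half+half {n} 2∣n = trans (cong (_+_ (n / 2)) (sym (ℕ.+-identityʳ (n / 2)))) (trans (ℕ.*-comm 2 (n / 2)) (m/n*n≡m 2∣n))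

∣half⇔2∣ : ∀ {k f h} .{{_ : NonZero k}} → h + h ≡ k * f → (k ∣ h) ⇔ (2 ∣ f)
∣half⇔2∣ {k} {f} {h} h+h≡kf = mk⇔
  (λ k∣h → *-cancelˡ-∣ k (subst₂ _∣_ (ℕ.*-comm 2 k) 2h≡kf (*-monoʳ-∣ 2 k∣h)))
  (λ 2∣f → *-cancelˡ-∣ 2 (subst₂ _∣_ (ℕ.*-comm k 2) (sym 2h≡kf) (*-monoʳ-∣ k 2∣f)))
  where
  2h≡kf : 2 * h ≡ k * f
  2h≡kf = trans (cong (_+_ h) (ℕ.+-identityʳ h)) h+h≡kf

∣ᵤ-diagonal⇔2∣ : ∀ {k f h} .{{_ : NonZero k}} → h + h ≡ k * f → ∀ i → (+ k ∣ℤ (i ℤ.- (i ℤ.+ + h))) ⇔ (2 ∣ f)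
∣ᵤ-diagonal⇔2∣ {k} {f} {h} h+h≡kf i = subst (λ n → (k ∣ n) ⇔ (2 ∣ f)) (sym ∣i-[i+h]∣≡h) (∣half⇔2∣ h+h≡kf)
  where
  negate : ∀ i h → i ℤ.- (i ℤ.+ h) ≡ - h
  negate = solve-∀
  ∣i-[i+h]∣≡h : ℤ.∣ i ℤ.- (i ℤ.+ + h) ∣ ≡ h
  ∣i-[i+h]∣≡h = trans (cong ℤ.∣_∣ (negate i (+ h))) (ℤ.∣-i∣≡∣i∣ (+ h))

module Formulas (F : FiniteField) {g : FiniteField.Carrier F} (gen : IsGenerator F g)
                (k f : ℕ) .{{_ : NonZero k}} .{{_ : NonZero f}} (size≡1+kf : FiniteField.size F ≡ suc (k * f))
                {h : ℕ} (h+h≡kf : h + h ≡ k * f) where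

  open Cyclotomy F gen k f size≡1+kf
  open PairCount using (tri-formula-≡; tri-formula-≢)

  shifted : ∀ i₁ i₂ → (+ k ∣ℤ (i₁ ℤ.- (i₂ ℤ.+ + h))) ⇔ (i₁ ℤ.+ + h ≡ i₂ [mod k ])
  shifted i₁ i₂ = ∣ᵤ⇔mod-half-shift {h = h} h+h≡kf {i₁} {i₂}

  tri-formula-∣ : ∀ i₁ i₂ i₃ → + k ∣ℤ (i₁ ℤ.- (i₂ ℤ.+ + h)) → + k ∣ℤ i₃ →
    tri F g k f i₁ i₂ i₃ ≡ f + sumBelow k (λ v → cyc F g k f (+ v ℤ.- i₃) (- i₃) * cyc F g k f (i₂ ℤ.- i₁) (+ v ℤ.- i₁))
  tri-formula-∣ i₁ i₂ i₃ k∣i₁-[i₂+h] k∣i₃ =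
    trans (tri-formula-≡ i₁ i₂ {h} h+h≡kf i₃ (to (shifted i₁ i₂) k∣i₁-[i₂+h]) (to ∣ᵤ⇔mod-0 k∣i₃))
          (cong (_+_ f) (convolution≡sumBelow i₁ i₂ i₃))

  tri-formula-∤ : ∀ i₁ i₂ i₃ → ¬ (+ k ∣ℤ (i₁ ℤ.- (i₂ ℤ.+ + h)) × + k ∣ℤ i₃) →
    tri F g k f i₁ i₂ i₃ ≡ sumBelow k (λ v → cyc F g k f (+ v ℤ.- i₃) (- i₃) * cyc F g k f (i₂ ℤ.- i₁) (+ v ℤ.- i₁))
  tri-formula-∤ i₁ i₂ i₃ ¬both =
    trans (tri-formula-≢ i₁ i₂ {h} h+h≡kf i₃ λ (c₁ , c₃) → ¬both (from (shifted i₁ i₂) c₁ , from ∣ᵤ⇔mod-0 c₃))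
          (convolution≡sumBelow i₁ i₂ i₃)

  tri-diagonal-∣ : ∀ i → + k ∣ℤ i → 2 ∣ f →
    tri F g k f i i i ≡ f + sumBelow k (λ v → cyc F g k f (+ v) (- i) * cyc F g k f (+ 0) (+ v))
  tri-diagonal-∣ i k∣i 2∣f =
    trans (tri-formula-∣ i i i (from (∣ᵤ-diagonal⇔2∣ h+h≡kf i) 2∣f) k∣i) (cong (_+_ f) (sumBelow-diagonal i))

  tri-diagonal-∤ : ∀ i → ¬ (+ k ∣ℤ i × 2 ∣ f) →
    tri F g k f i i i ≡ sumBelow k (λ v → cyc F g k f (+ v) (- i) * cyc F g k f (+ 0) (+ v))
  tri-diagonal-∤ i ¬both =
    trans (tri-formula-∤ i i i λ (c₁ , c₃) → ¬both (c₃ , to (∣ᵤ-diagonal⇔2∣ h+h≡kf i) c₁)) (sumBelow-diagonal i)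

lemma2p13 : (F : FiniteField) (p m k f : ℕ) → Prime p → ¬ (2 ∣ p)
    → FiniteField.size F ≡ p ^ m → 1 ≤ k → 1 ≤ f → p ^ m ∸ 1 ≡ k * f
    → (g : FiniteField.Carrier F) → IsGenerator F g
    → (∀ (i₁ i₂ i₃ : ℤ)
        → ((+ k ∣ℤ (i₁ Data.Integer.- (i₂ Data.Integer.+ + ((k * f) / 2)))) → (+ k ∣ℤ i₃)
            → tri F g k f i₁ i₂ i₃ ≡ f + sumBelow k (λ v → cyc F g k f (+ v Data.Integer.- i₃) (- i₃) * cyc F g k f (i₂ Data.Integer.- i₁) (+ v Data.Integer.- i₁)))
        × (¬ ((+ k ∣ℤ (i₁ Data.Integer.- (i₂ Data.Integer.+ + ((k * f) / 2)))) × (+ k ∣ℤ i₃))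
            → tri F g k f i₁ i₂ i₃ ≡ sumBelow k (λ v → cyc F g k f (+ v Data.Integer.- i₃) (- i₃) * cyc F g k f (i₂ Data.Integer.- i₁) (+ v Data.Integer.- i₁))))
      × (∀ (i : ℤ)
        → ((+ k ∣ℤ i) → 2 ∣ f
            → tri F g k f i i i ≡ f + sumBelow k (λ v → cyc F g k f (+ v) (- i) * cyc F g k f (+ 0) (+ v)))
        × (¬ ((+ k ∣ℤ i) × (2 ∣ f))
            → tri F g k f i i i ≡ sumBelow k (λ v → cyc F g k f (+ v) (- i) * cyc F g k f (+ 0) (+ v))))
lemma2p13 F p m k@(suc _) f@(suc _) _ 2∤p size≡pᵐ _ _ pᵐ∸1≡kf g gen =
    (λ i₁ i₂ i₃ → tri-formula-∣ i₁ i₂ i₃ , tri-formula-∤ i₁ i₂ i₃)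
  , (λ i → tri-diagonal-∣ i , tri-diagonal-∤ i)
  where
  parity : p ^ m ≡ suc (k * f) × 2 ∣ k * f
  parity = odd⇒suc-even (odd-^ m 2∤p) pᵐ∸1≡kf
  open Formulas F gen k f (trans size≡pᵐ (proj₁ parity)) {h = (k * f) / 2} (half+half (proj₂ parity))
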